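{- The cut-off function $x\dot- y=\begin{cases}0 & x<y\\ x-y & x\ge y\end{cases}$ on $\mathbb N$ is not provably recursive in $\mathbf{BA}$.
   Context: Basic Arithmetic $\mathbf{BA}$ (Ruitenburg) is the following theory of sequents $A\Rightarrow B$ in the language $\{0,S,+,\cdot\}$, where formulas are built from atomic formulas ($s=t$, $\top$, $\bot$) by $\land,\lor,\exists x$ and the former $\forall\mathbf x(A\to B)$ ($\mathbf x$ a finite, possibly empty, sequence of variables; empty gives $A\to B$). Logical part (Basic Predicate Calculus): axioms $A\Rightarrow A$; $A\Rightarrow\top$; $\bot\Rightarrow A$; $A\land(B\lor C)\Rightarrow(A\land B)\lor(A\land C)$; $A\land\exists xB\Rightarrow\exists x(A\land B)$ ($x$ not free in $A$); $\top\Rightarrow x=x$; $x=y\land A\Rightarrow A[x/y]$ ($A$ atomic); $\forall\mathbf x(A\to B)\land\forall\mathbf x(B\to C)\Rightarrow\forall\mathbf x(A\to C)$; $\forall\mathbf x(A\to B)\land\forall\mathbf x(A\to C)\Rightarrow\forall\mathbf x(A\to B\land C)$; $\forall\mathbf x(B\to A)\land\forall\mathbf x(C\to A)\Rightarrow\forall\mathbf x(B\lor C\to A)$; $\forall\mathbf x(A\to B)\Rightarrow\forall\mathbf x(A[\mathbf x/\mathbf t]\to B[\mathbf x/\mathbf t])$; $\forall\mathbf x(A\to B)\Rightarrow\forall\mathbf y(A\to B)$ (no variable of $\mathbf y$ free on the left); $\forall\mathbf yx(B\to A)\Rightarrow\forall\mathbf y(\exists xB\to A)$ ($x$ not free in $A$);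 rules: transitivity; $A\Rightarrow B\land C$ iff $A\Rightarrow B$ and $A\Rightarrow C$; $B\lor C\Rightarrow A$ iff $B\Rightarrow A$ and $C\Rightarrow A$; term substitution; $\exists xB\Rightarrow A$ iff $B\Rightarrow A$ ($x$ not free in $A$); from $A\land B\Rightarrow C$ infer $A\Rightarrow\forall\mathbf x(B\to C)$ (no variable of $\mathbf x$ free in $A$). Arithmetic part: $Sx=0\Rightarrow\bot$; $Sx=Sy\Rightarrow x=y$; $x+0=x$; $x+Sy=S(x+y)$; $x\cdot0=0$; $x\cdot Sy=x\cdot y+x$; induction axiom schema $\forall\mathbf yx(A\to A[x/Sx])\Rightarrow\forall\mathbf yx(A[x/0]\to A)$; induction rule: from $A\Rightarrow A[x/Sx]$ infer $A[x/0]\Rightarrow A$. $s<t$ abbreviates $\exists x(s+Sx=t)$. $\Delta_0$: smallest class containing atomic formulas, closed under $\land,\lor,\to$ and bounded quantifiers $\exists x(x<s\land A)$, $\forall x(x<s\to A)$; $\Sigma_1$: $\exists\mathbf xA$ with $A\in\Delta_0$. A function $f:\mathbb N^n\to\mathbb N$ is provably recursive in $\mathbf{BA}$ if there is a $\Sigma_1$ formula $A(\mathbf x,y)$ with $\mathbb N\models A(\mathbf a,b)\iff f(\mathbf a)=b$ for all $\mathbf a,b$, such that $\mathbf{BA}\vdash\top\Rightarrow\exists yA(\mathbf x,y)$ and $\mathbf{BA}\vdash A(\mathbf x,u)\land A(\mathbf x,v)\Rightarrow u=v$ ($u,v$ fresh). -}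

module Defs where

open import Data.Nat using (ℕ; zero; suc; _+_; _*_; _∸_; _≡ᵇ_)
open import Data.Bool using (Bool; true; false; if_then_else_; _∨_; _∧_; not)
open import Data.List using (List; []; _∷_; _++_)
open import Data.Bool.ListAction using (any)
open import Data.List.Relation.Unary.All using (All)
open import Data.List.Relation.Unary.Unique.Propositional using (Unique)
open import Data.List.Membership.Propositional using (_∈_)
open import Data.Vec using (Vec; []; _∷_; toList)
open import Data.Product using (Σ; _×_; _,_)
open import Data.Sum using (_⊎_)
open import Data.Unit using (⊤)
open import Data.Empty using (⊥)
open import Relation.Binary.PropositionalEquality using (_≡_; _≢_)

data Term : Set where
  var : ℕ → Term
  𝟎   : Term
  S   : Term → Term
  _⊕_ : Term → Term → Term
  _⊗_ : Term → Term → Term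

infixl 6 _⊕_
infixl 7 _⊗_

-- Formulas of basic logic: atoms s = t, ⊤, ⊥; ∧, ∨, ∃x, and the
-- former ∀𝐱(A → B) for a finite (possibly empty) list of variables 𝐱.
data Formula : Set where
  _≐_  : Term → Term → Formula
  ⊤f   : Formula
  ⊥f   : Formula
  _∧f_ : Formula → Formula → Formula
  _∨f_ : Formula → Formula → Formula
  ∃f   : ℕ → Formula → Formula
  ∀f   : List ℕ → Formula → Formula → Formula

infix 4 _≐_
infixr 3 _∧f_
infixr 2 _∨f_

_⟶_ : Formula → Formula → Formula
A ⟶ B = ∀f [] A B

data Atomic : Formula → Set where
  at-≐ : ∀ {s t} → Atomic (s ≐ t)
  at-⊤ : Atomic ⊤f
  at-⊥ : Atomic ⊥f

elemᵇ : ℕ → List ℕ → Bool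
elemᵇ y xs = any (y ≡ᵇ_) xs

occT : ℕ → Term → Bool
occT x (var y)  = x ≡ᵇ y
occT x 𝟎        = false
occT x (S t)    = occT x t
occT x (s ⊕ t)  = occT x s ∨ occT x t
occT x (s ⊗ t)  = occT x s ∨ occT x t

freeIn : ℕ → Formula → Bool
freeIn x (s ≐ t)     = occT x s ∨ occT x t
freeIn x ⊤f          = false
freeIn x ⊥f          = false
freeIn x (A ∧f B)    = freeIn x A ∨ freeIn x B
freeIn x (A ∨f B)    = freeIn x A ∨ freeIn x B
freeIn x (∃f y A)    = not (x ≡ᵇ y) ∧ freeIn x A
freeIn x (∀f ys A B) = not (elemᵇ x ys) ∧ (freeIn x A ∨ freeIn x B)

NotFree : ℕ → Formula → Set
NotFree x A = freeIn x A ≡ false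

-- Substitution (simultaneous, naive; used together with the
-- "substitutable" side condition SubOK below).

Subst : Set
Subst = ℕ → Term

upd : ℕ → Term → Subst → Subst
upd x t σ y = if y ≡ᵇ x then t else σ y

bindL : List ℕ → Subst → Subst
bindL xs σ y = if elemᵇ y xs then var y else σ y

multi : List ℕ → List Term → Subst
multi (x ∷ xs) (t ∷ ts) y = if y ≡ᵇ x then t else multi xs ts y
multi _        _        y = var y

subT : Subst → Term → Term
subT σ (var y) = σ y
subT σ 𝟎       = 𝟎
subT σ (S t)   = S (subT σ t)
subT σ (s ⊕ t) = subT σ s ⊕ subT σ t
subT σ (s ⊗ t) = subT σ s ⊗ subT σ t

sub : Subst → Formula → Formula
sub σ (s ≐ t)     = subT σ s ≐ subT σ t
sub σ ⊤f          = ⊤f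
sub σ ⊥f          = ⊥f
sub σ (A ∧f B)    = sub σ A ∧f sub σ B
sub σ (A ∨f B)    = sub σ A ∨f sub σ B
sub σ (∃f x A)    = ∃f x (sub (upd x (var x) σ) A)
sub σ (∀f xs A B) = ∀f xs (sub (bindL xs σ) A) (sub (bindL xs σ) B)

-- σ is free for (substitutable in) the formula: no variable of an
-- inserted term gets captured by a quantifier.
SubOK : Subst → Formula → Set
SubOK σ (s ≐ t)     = ⊤
SubOK σ ⊤f          = ⊤
SubOK σ ⊥f          = ⊤
SubOK σ (A ∧f B)    = SubOK σ A × SubOK σ B
SubOK σ (A ∨f B)    = SubOK σ A × SubOK σ B
SubOK σ (∃f x A)    =
  SubOK (upd x (var x) σ) A ×
  ((y : ℕ) → freeIn y (∃f x A) ≡ true → occT x (σ y) ≡ false)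
SubOK σ (∀f xs A B) =
  SubOK (bindL xs σ) A × SubOK (bindL xs σ) B ×
  ((y : ℕ) → freeIn y (∀f xs A B) ≡ true →
     All (λ x → occT x (σ y) ≡ false) xs)

_[_≔_] : Formula → ℕ → Term → Formula
A [ x ≔ t ] = sub (upd x t var) A

SubOK1 : ℕ → Term → Formula → Set
SubOK1 x t A = SubOK (upd x t var) A

infix 1 _⇒_

data _⇒_ : Formula → Formula → Set where
  ax-id    : ∀ {A} → A ⇒ A
  ax-⊤     : ∀ {A} → A ⇒ ⊤f
  ax-⊥     : ∀ {A} → ⊥f ⇒ A
  ax-dist  : ∀ {A B C} → A ∧f (B ∨f C) ⇒ (A ∧f B) ∨f (A ∧f C)
  ax-∧∃    : ∀ {A B x} → NotFree x A → A ∧f ∃f x B ⇒ ∃f x (A ∧f B)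
  ax-refl  : ∀ {x} → ⊤f ⇒ var x ≐ var x
  ax-eq    : ∀ {x y A} → Atomic A → (var x ≐ var y) ∧f A ⇒ A [ x ≔ var y ]
  ax-trans : ∀ {xs A B C} → ∀f xs A B ∧f ∀f xs B C ⇒ ∀f xs A C
  ax-∧     : ∀ {xs A B C} → ∀f xs A B ∧f ∀f xs A C ⇒ ∀f xs A (B ∧f C)
  ax-∨     : ∀ {xs A B C} → ∀f xs B A ∧f ∀f xs C A ⇒ ∀f xs (B ∨f C) A
  ax-inst  : ∀ {xs ts A B} → SubOK (multi xs ts) A → SubOK (multi xs ts) B →
             ∀f xs A B ⇒ ∀f xs (sub (multi xs ts) A) (sub (multi xs ts) B)
  ax-gen   : ∀ {xs ys A B} → All (λ y → NotFree y (∀f xs A B)) ys →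
             ∀f xs A B ⇒ ∀f ys A B
  ax-∃     : ∀ {ys x A B} → NotFree x A →
             ∀f (ys ++ x ∷ []) B A ⇒ ∀f ys (∃f x B) A
  r-trans  : ∀ {A B C} → A ⇒ B → B ⇒ C → A ⇒ C
  r-∧I     : ∀ {A B C} → A ⇒ B → A ⇒ C → A ⇒ B ∧f C
  r-∧E₁    : ∀ {A B C} → A ⇒ B ∧f C → A ⇒ B
  r-∧E₂    : ∀ {A B C} → A ⇒ B ∧f C → A ⇒ C
  r-∨I     : ∀ {A B C} → B ⇒ A → C ⇒ A → B ∨f C ⇒ A
  r-∨E₁    : ∀ {A B C} → B ∨f C ⇒ A → B ⇒ A
  r-∨E₂    : ∀ {A B C} → B ∨f C ⇒ A → C ⇒ A
  r-subst  : ∀ {A B x t} → SubOK1 x t A → SubOK1 x t B →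
             A ⇒ B → A [ x ≔ t ] ⇒ B [ x ≔ t ]
  r-∃I     : ∀ {A B x} → NotFree x A → B ⇒ A → ∃f x B ⇒ A
  r-∃E     : ∀ {A B x} → NotFree x A → ∃f x B ⇒ A → B ⇒ A
  r-→I     : ∀ {A B C xs} → All (λ x → NotFree x A) xs →
             A ∧f B ⇒ C → A ⇒ ∀f xs B C
  ax-S0    : ∀ {x} → S (var x) ≐ 𝟎 ⇒ ⊥f
  ax-SS    : ∀ {x y} → S (var x) ≐ S (var y) ⇒ var x ≐ var y
  ax-+0    : ∀ {x} → ⊤f ⇒ var x ⊕ 𝟎 ≐ var x
  ax-+S    : ∀ {x y} → ⊤f ⇒ var x ⊕ S (var y) ≐ S (var x ⊕ var y)
  ax-·0    : ∀ {x} → ⊤f ⇒ var x ⊗ 𝟎 ≐ 𝟎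
  ax-·S    : ∀ {x y} → ⊤f ⇒ var x ⊗ S (var y) ≐ var x ⊗ var y ⊕ var x
  ax-ind   : ∀ {ys x A} →
             ∀f (ys ++ x ∷ []) A (A [ x ≔ S (var x) ]) ⇒
             ∀f (ys ++ x ∷ []) (A [ x ≔ 𝟎 ]) A
  r-ind    : ∀ {A x} → A ⇒ A [ x ≔ S (var x) ] → A [ x ≔ 𝟎 ] ⇒ A

Lt : ℕ → ℕ → Term → Formula
Lt z x s = ∃f z (var x ⊕ S (var z) ≐ s)

data Δ₀ : Formula → Set where
  d-atom : ∀ {A} → Atomic A → Δ₀ A
  d-∧    : ∀ {A B} → Δ₀ A → Δ₀ B → Δ₀ (A ∧f B)
  d-∨    : ∀ {A B} → Δ₀ A → Δ₀ B → Δ₀ (A ∨f B)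
  d-→    : ∀ {A B} → Δ₀ A → Δ₀ B → Δ₀ (A ⟶ B)
  d-∃<   : ∀ {x z s A} → occT x s ≡ false → z ≢ x → occT z s ≡ false →
           Δ₀ A → Δ₀ (∃f x (Lt z x s ∧f A))
  d-∀<   : ∀ {x z s A} → occT x s ≡ false → z ≢ x → occT z s ≡ false →
           Δ₀ A → Δ₀ (∀f (x ∷ []) (Lt z x s) A)

data Σ₁ : Formula → Set where
  s-Δ₀ : ∀ {A} → Δ₀ A → Σ₁ A
  s-∃  : ∀ {x A} → Σ₁ A → Σ₁ (∃f x A)

Env : Set
Env = ℕ → ℕ

setE : ℕ → ℕ → Env → Env
setE x n ρ y = if y ≡ᵇ x then n else ρ y

overrideE : List ℕ → Env → Env → Env
overrideE xs τ ρ y = if elemᵇ y xs then τ y else ρ y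

evalT : Env → Term → ℕ
evalT ρ (var x) = ρ x
evalT ρ 𝟎       = 0
evalT ρ (S t)   = suc (evalT ρ t)
evalT ρ (s ⊕ t) = evalT ρ s + evalT ρ t
evalT ρ (s ⊗ t) = evalT ρ s * evalT ρ t

_⊨_ : Env → Formula → Set
ρ ⊨ (s ≐ t)     = evalT ρ s ≡ evalT ρ t
ρ ⊨ ⊤f          = ⊤
ρ ⊨ ⊥f          = ⊥
ρ ⊨ (A ∧f B)    = (ρ ⊨ A) × (ρ ⊨ B)
ρ ⊨ (A ∨f B)    = (ρ ⊨ A) ⊎ (ρ ⊨ B)
ρ ⊨ (∃f x A)    = Σ ℕ (λ n → setE x n ρ ⊨ A)
ρ ⊨ (∀f xs A B) = (τ : Env) → overrideE xs τ ρ ⊨ A → overrideE xs τ ρ ⊨ B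

assign : ∀ {n} → Vec ℕ n → Vec ℕ n → Env
assign []       []       = λ _ → 0
assign (x ∷ xs) (a ∷ as) = setE x a (assign xs as)

record ProvablyRecursive (n : ℕ) (f : Vec ℕ n → ℕ) : Set where
  field
    A      : Formula
    xs     : Vec ℕ n
    y      : ℕ
    A-Σ₁   : Σ₁ A
    distinct : Unique (y ∷ toList xs)
    freeVars : (z : ℕ) → freeIn z A ≡ true → z ∈ (y ∷ toList xs)
    sound    : (as : Vec ℕ n) (b : ℕ) → setE y b (assign xs as) ⊨ A → f as ≡ b
    complete : (as : Vec ℕ n) (b : ℕ) → f as ≡ b → setE y b (assign xs as) ⊨ A
    total  : ⊤f ⇒ ∃f y A
    u v    : ℕ
    u≢v    : u ≢ v
    u-fresh : (u ∈ (y ∷ toList xs) → ⊥)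
    v-fresh : (v ∈ (y ∷ toList xs) → ⊥)
    u-ok   : SubOK1 y (var u) A
    v-ok   : SubOK1 y (var v) A
    unique : A [ y ≔ var u ] ∧f A [ y ≔ var v ] ⇒ var u ≐ var v

monus : Vec ℕ 2 → ℕ
monus (a ∷ b ∷ []) = a ∸ b

-- Interpret BA in ℕ∞ = ℕ ∪ {∞}, reading every former ∀𝐱(A → B) as true and
-- ∨, ∃ classically (through double negation, so that the argument stays
-- constructive). Every axiom and rule of BA is sound for this interpretation;
-- the only delicate case is the induction rule at x = ∞. It is handled by a
-- topological fact: for the topology in which ∞ is the limit of 0, 1, 2, …,
-- the set of assignments satisfying a formula is closed, since the model
-- operations are continuous and formers are constantly true. Hence truth at
-- every finite n passes to ∞.
--
-- If A(x₁, x₂, y) defined x₁ ∸ x₂, then A(n + k, n, k) holds for all n, k,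
-- and letting n → ∞ gives A(∞, ∞, k) for every k, in particular for k = 0 and
-- k = 1. The sequent A(x₁, x₂, u) ∧ A(x₁, x₂, v) ⇒ u = v is then false in the
-- model, so it is not derivable.
module Submission where

open import Defs
open import Data.Bool using (true; false; T; not; if_then_else_; _∨_)
open import Data.Bool.Properties using (∨-zeroʳ; ∧-conicalˡ; ∧-conicalʳ; not-injective)
open import Data.Empty using (⊥; ⊥-elim)
open import Data.List using ([]; _∷_)
open import Data.List.Membership.Propositional using (_∈_; _∉_)
open import Data.List.Relation.Unary.Any using (here; there)
open import Data.List.Relation.Unary.All using ([]; _∷_)
open import Data.List.Relation.Unary.AllPairs using (_∷_)
open import Data.List.Relation.Unary.Unique.Propositional using (Unique)
open import Data.Nat using (ℕ; zero; suc; _+_; _*_; _≡ᵇ_; _≤_; _<_; _⊔_; z≤n; s≤s; _≤?_)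
open import Data.Nat.Properties
open import Data.Product using (Σ; _×_; _,_; proj₁; proj₂; map₂) renaming (map to ×-map)
open import Data.Sum using (_⊎_; inj₁; inj₂; [_,_]) renaming (map to ⊎-map)
open import Data.Unit using (⊤; tt)
open import Data.Vec using ([]; _∷_)
open import Effect.Monad using (RawMonad)
open import Level using (0ℓ)
open import Function using (_∘_; id; _⇔_; mk⇔; Equivalence)
open import Relation.Binary.PropositionalEquality
  using (_≡_; _≢_; refl; sym; trans; cong; cong₂; subst; _≗_)
open import Relation.Nullary using (¬_; Dec; yes; no; Stable)
open import Relation.Nullary.Negation using (¬¬-map; ¬¬-Monad)

open Equivalence using (to; from)
open RawMonad (¬¬-Monad {0ℓ}) using (_>>=_; return)

true≢false : true ≢ false
true≢false ()

≡ᵇ-refl : ∀ n → (n ≡ᵇ n) ≡ true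
≡ᵇ-refl zero    = refl
≡ᵇ-refl (suc n) = ≡ᵇ-refl n

≡ᵇ-true⇒≡ : ∀ {m n} → (m ≡ᵇ n) ≡ true → m ≡ n
≡ᵇ-true⇒≡ {m} {n} e = ≡ᵇ⇒≡ m n (subst T (sym e) tt)

≡ᵇ-false⇒≢ : ∀ {m n} → (m ≡ᵇ n) ≡ false → m ≢ n
≡ᵇ-false⇒≢ {m} e refl = true≢false (trans (sym (≡ᵇ-refl m)) e)

≢⇒≡ᵇ-false : ∀ {m n} → m ≢ n → (m ≡ᵇ n) ≡ false
≢⇒≡ᵇ-false {m} {n} m≢n with m ≡ᵇ n in e
... | true  = ⊥-elim (m≢n (≡ᵇ-true⇒≡ e))
... | false = refl

∨-trueˡ : ∀ {a} b → a ≡ true → (a ∨ b) ≡ true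
∨-trueˡ b refl = refl

∨-trueʳ : ∀ a {b} → b ≡ true → (a ∨ b) ≡ true
∨-trueʳ a refl = ∨-zeroʳ a

free-∃⇒≢ : ∀ {z x} A → freeIn z (∃f x A) ≡ true → z ≢ x
free-∃⇒≢ {z} {x} A fz = ≡ᵇ-false⇒≢ (not-injective (∧-conicalˡ (not (z ≡ᵇ x)) (freeIn z A) fz))

free-∃⇒free : ∀ {z x} A → freeIn z (∃f x A) ≡ true → freeIn z A ≡ true
free-∃⇒free {z} {x} A = ∧-conicalʳ (not (z ≡ᵇ x)) (freeIn z A)

free⇒free-∃ : ∀ {z x} A → z ≢ x → freeIn z A ≡ true → freeIn z (∃f x A) ≡ true
free⇒free-∃ A z≢x fz rewrite ≢⇒≡ᵇ-false z≢x = fz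

free⇒≢ : ∀ {z x} A → freeIn z A ≡ true → NotFree x A → z ≢ x
free⇒≢ A fz nf refl = true≢false (trans (sym fz) nf)

data ℕ∞ : Set where
  fin : ℕ → ℕ∞
  ∞   : ℕ∞

fin-injective : ∀ {a b} → fin a ≡ fin b → a ≡ b
fin-injective refl = refl

_≟∞_ : (a b : ℕ∞) → Dec (a ≡ b)
fin a ≟∞ fin b with a ≟ b
... | yes refl = yes refl
... | no a≢b   = no (a≢b ∘ fin-injective)
fin _ ≟∞ ∞     = no λ ()
∞     ≟∞ fin _ = no λ ()
∞     ≟∞ ∞     = yes refl

suc∞ : ℕ∞ → ℕ∞
suc∞ (fin n) = fin (suc n)
suc∞ ∞       = ∞

infixl 6 _+∞_
infixl 7 _*∞_

_+∞_ : ℕ∞ → ℕ∞ → ℕ∞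
fin a +∞ fin b = fin (a + b)
fin _ +∞ ∞     = ∞
∞     +∞ _     = ∞

-- ∞ · 0 = 0 is forced by x · 0 = 0; 0 · ∞ = 0 keeps multiplication continuous.
_*∞_ : ℕ∞ → ℕ∞ → ℕ∞
fin a       *∞ fin b       = fin (a * b)
fin zero    *∞ ∞           = fin 0
fin (suc _) *∞ ∞           = ∞
∞           *∞ fin zero    = fin 0
∞           *∞ fin (suc _) = ∞
∞           *∞ ∞           = ∞

suc∞-injective : ∀ {a b} → suc∞ a ≡ suc∞ b → a ≡ b
suc∞-injective {fin _} {fin _} e = cong fin (suc-injective (fin-injective e))
suc∞-injective {∞}     {∞}     _ = refl

suc∞≢0 : ∀ a → suc∞ a ≢ fin 0
suc∞≢0 (fin _) ()
suc∞≢0 ∞       ()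

+∞-identityʳ : ∀ a → a +∞ fin 0 ≡ a
+∞-identityʳ (fin a) = cong fin (+-identityʳ a)
+∞-identityʳ ∞       = refl

+∞-suc : ∀ a b → a +∞ suc∞ b ≡ suc∞ (a +∞ b)
+∞-suc (fin a) (fin b) = cong fin (+-suc a b)
+∞-suc (fin _) ∞       = refl
+∞-suc ∞       _       = refl

*∞-zeroˡ : ∀ a → fin 0 *∞ a ≡ fin 0
*∞-zeroˡ (fin _) = refl
*∞-zeroˡ ∞       = refl

*∞-zeroʳ : ∀ a → a *∞ fin 0 ≡ fin 0
*∞-zeroʳ (fin a) = cong fin (*-zeroʳ a)
*∞-zeroʳ ∞       = refl

*∞-comm : ∀ a b → a *∞ b ≡ b *∞ a
*∞-comm (fin a)       (fin b)       = cong fin (*-comm a b)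
*∞-comm (fin zero)    ∞             = refl
*∞-comm (fin (suc _)) ∞             = refl
*∞-comm ∞             (fin zero)    = refl
*∞-comm ∞             (fin (suc _)) = refl
*∞-comm ∞             ∞             = refl

*∞-suc : ∀ a b → a *∞ suc∞ b ≡ a *∞ b +∞ a
*∞-suc (fin a)       (fin b)       = cong fin (trans (*-suc a b) (+-comm a (a * b)))
*∞-suc (fin zero)    ∞             = refl
*∞-suc (fin (suc _)) ∞             = refl
*∞-suc ∞             (fin zero)    = refl
*∞-suc ∞             (fin (suc _)) = refl
*∞-suc ∞             ∞             = refl

set : {X : Set} → ℕ → X → (ℕ → X) → ℕ → X
set x a ρ z = if z ≡ᵇ x then a else ρ z

set-≡ : ∀ {X} x {a : X} ρ → set x a ρ x ≡ a
set-≡ x ρ rewrite ≡ᵇ-refl x = refl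

set-≢ : ∀ {X} {x z} {a : X} ρ → z ≢ x → set x a ρ z ≡ ρ z
set-≢ ρ z≢x rewrite ≢⇒≡ᵇ-false z≢x = refl

set-agree : ∀ {X} {x z} {a : X} {ρ ρ′} → (z ≢ x → ρ z ≡ ρ′ z) → set x a ρ z ≡ set x a ρ′ z
set-agree {x = x} {z} h with z ≡ᵇ x in e
... | true  = refl
... | false = h (≡ᵇ-false⇒≢ e)

set-pointwise : ∀ {X Y : Set} (R : X → Y → Set) {x a b ρ ρ′} →
                R a b → (∀ z → R (ρ z) (ρ′ z)) → ∀ z → R (set x a ρ z) (set x b ρ′ z)
set-pointwise R {x} Rab Rρρ′ z with z ≡ᵇ x
... | true  = Rab
... | false = Rρρ′ z

set-id : ∀ {X} x {a : X} {ρ} → ρ x ≡ a → set x a ρ ≗ ρ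
set-id x {ρ = ρ} ρx≡a z with z ≡ᵇ x in e
... | true  = trans (sym ρx≡a) (cong ρ (sym (≡ᵇ-true⇒≡ e)))
... | false = refl

set-shadow : ∀ {X} x {a b : X} ρ → set x b (set x a ρ) ≗ set x b ρ
set-shadow x ρ z with z ≡ᵇ x
... | true  = refl
... | false = refl

Env∞ : Set
Env∞ = ℕ → ℕ∞

eval∞ : Env∞ → Term → ℕ∞
eval∞ ρ (var x) = ρ x
eval∞ ρ 𝟎       = fin 0
eval∞ ρ (S t)   = suc∞ (eval∞ ρ t)
eval∞ ρ (s ⊕ t) = eval∞ ρ s +∞ eval∞ ρ t
eval∞ ρ (s ⊗ t) = eval∞ ρ s *∞ eval∞ ρ t

infix 1 _⊩_

_⊩_ : Env∞ → Formula → Set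
ρ ⊩ s ≐ t     = eval∞ ρ s ≡ eval∞ ρ t
ρ ⊩ ⊤f        = ⊤
ρ ⊩ ⊥f        = ⊥
ρ ⊩ A ∧f B    = (ρ ⊩ A) × (ρ ⊩ B)
ρ ⊩ A ∨f B    = ¬ ¬ ((ρ ⊩ A) ⊎ (ρ ⊩ B))
ρ ⊩ ∃f x A    = ¬ ¬ Σ ℕ∞ λ a → set x a ρ ⊩ A
ρ ⊩ ∀f _ _ _  = ⊤

⊩-stable : ∀ A {ρ} → Stable (ρ ⊩ A)
⊩-stable (s ≐ t) {ρ} ¬¬e with eval∞ ρ s ≟∞ eval∞ ρ t
... | yes e = e
... | no ¬e = ⊥-elim (¬¬e ¬e)
⊩-stable ⊤f         _   = tt
⊩-stable ⊥f         ¬¬⊥ = ¬¬⊥ id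
⊩-stable (A ∧f B)   ¬¬p = ⊩-stable A (¬¬-map proj₁ ¬¬p) , ⊩-stable B (¬¬-map proj₂ ¬¬p)
⊩-stable (A ∨f B)   ¬¬p = λ k → ¬¬p (λ p → p k)
⊩-stable (∃f x A)   ¬¬p = λ k → ¬¬p (λ p → p k)
⊩-stable (∀f _ _ _) _   = tt

eval∞-coincide : ∀ t {ρ ρ′} → (∀ z → occT z t ≡ true → ρ z ≡ ρ′ z) → eval∞ ρ t ≡ eval∞ ρ′ t
eval∞-coincide (var x) h = h x (≡ᵇ-refl x)
eval∞-coincide 𝟎       h = refl
eval∞-coincide (S t)   h = cong suc∞ (eval∞-coincide t h)
eval∞-coincide (s ⊕ t) h = cong₂ _+∞_ (eval∞-coincide s (λ z → h z ∘ ∨-trueˡ (occT z t)))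
                                       (eval∞-coincide t (λ z → h z ∘ ∨-trueʳ (occT z s)))
eval∞-coincide (s ⊗ t) h = cong₂ _*∞_ (eval∞-coincide s (λ z → h z ∘ ∨-trueˡ (occT z t)))
                                       (eval∞-coincide t (λ z → h z ∘ ∨-trueʳ (occT z s)))

⊩-coincide : ∀ A {ρ ρ′} → (∀ z → freeIn z A ≡ true → ρ z ≡ ρ′ z) → ρ ⊩ A → ρ′ ⊩ A
⊩-coincide (s ≐ t) h e =
  trans (sym (eval∞-coincide s (λ z → h z ∘ ∨-trueˡ (occT z t))))
        (trans e (eval∞-coincide t (λ z → h z ∘ ∨-trueʳ (occT z s))))
⊩-coincide ⊤f h _ = tt
⊩-coincide ⊥f h ()
⊩-coincide (A ∧f B) h =
  ×-map (⊩-coincide A (λ z → h z ∘ ∨-trueˡ (freeIn z B)))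
        (⊩-coincide B (λ z → h z ∘ ∨-trueʳ (freeIn z A)))
⊩-coincide (A ∨f B) h =
  ¬¬-map (⊎-map (⊩-coincide A (λ z → h z ∘ ∨-trueˡ (freeIn z B)))
                (⊩-coincide B (λ z → h z ∘ ∨-trueʳ (freeIn z A))))
⊩-coincide (∃f x A) {ρ} {ρ′} h =
  ¬¬-map (map₂ λ {a} → ⊩-coincide A λ z fz →
    set-agree {x = x} {z} {a} {ρ} {ρ′} (λ z≢x → h z (free⇒free-∃ A z≢x fz)))
⊩-coincide (∀f _ _ _) h _ = tt

⊩-cong : ∀ A {ρ ρ′} → ρ ≗ ρ′ → ρ ⊩ A → ρ′ ⊩ A
⊩-cong A ρ≗ρ′ = ⊩-coincide A (λ z _ → ρ≗ρ′ z)

⊩-set-notFree : ∀ A {x a ρ} → NotFree x A → set x a ρ ⊩ A → ρ ⊩ A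
⊩-set-notFree A {a = a} {ρ} nf = ⊩-coincide A (λ z fz → set-≢ {a = a} ρ (free⇒≢ A fz nf))

⊩-notFree-set : ∀ A {x a ρ} → NotFree x A → ρ ⊩ A → set x a ρ ⊩ A
⊩-notFree-set A {a = a} {ρ} nf = ⊩-coincide A (λ z fz → sym (set-≢ {a = a} ρ (free⇒≢ A fz nf)))

-- SubOK without the conditions below formers, which the model ignores.
FreeFor : Subst → Formula → Set
FreeFor σ (A ∧f B)    = FreeFor σ A × FreeFor σ B
FreeFor σ (A ∨f B)    = FreeFor σ A × FreeFor σ B
FreeFor σ (∃f x A)    =
  FreeFor (upd x (var x) σ) A × ((z : ℕ) → freeIn z (∃f x A) ≡ true → occT x (σ z) ≡ false)
FreeFor σ _           = ⊤

SubOK⇒FreeFor : ∀ A {σ} → SubOK σ A → FreeFor σ A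
SubOK⇒FreeFor (s ≐ t)     _               = tt
SubOK⇒FreeFor ⊤f          _               = tt
SubOK⇒FreeFor ⊥f          _               = tt
SubOK⇒FreeFor (A ∧f B)    (okA , okB)     = SubOK⇒FreeFor A okA , SubOK⇒FreeFor B okB
SubOK⇒FreeFor (A ∨f B)    (okA , okB)     = SubOK⇒FreeFor A okA , SubOK⇒FreeFor B okB
SubOK⇒FreeFor (∃f x A)    (okA , capture) = SubOK⇒FreeFor A okA , capture
SubOK⇒FreeFor (∀f _ _ _)  _               = tt

Atomic⇒FreeFor : ∀ {A σ} → Atomic A → FreeFor σ A
Atomic⇒FreeFor at-≐ = tt
Atomic⇒FreeFor at-⊤ = tt
Atomic⇒FreeFor at-⊥ = tt

-- The induction rule has no substitutability side condition: [x ≔ Sx] and [x ≔ 0]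
-- cannot capture, as they only replace x by terms whose sole variable is x.
MovesOnly : ℕ → Subst → Set
MovesOnly x σ = (∀ z → z ≢ x → σ z ≡ var z) × (∀ w → occT w (σ x) ≡ true → w ≡ x)

upd-movesOnly : ∀ {x t} → (∀ w → occT w t ≡ true → w ≡ x) → MovesOnly x (upd x t var)
upd-movesOnly {x} {t} only-x =
  (λ z → set-≢ var) , (λ w → only-x w ∘ subst (λ s → occT w s ≡ true) (set-≡ x var))

MovesOnly⇒FreeFor : ∀ A {x σ} → MovesOnly x σ → FreeFor σ A
MovesOnly⇒FreeFor (A ∧f B) m = MovesOnly⇒FreeFor A m , MovesOnly⇒FreeFor B m
MovesOnly⇒FreeFor (A ∨f B) m = MovesOnly⇒FreeFor A m , MovesOnly⇒FreeFor B m
MovesOnly⇒FreeFor (∃f y A) {x} {σ} (fixes , only-x) =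
  MovesOnly⇒FreeFor A {x} (fixes′ , only-x′) , no-capture
  where
  fixes′ : ∀ z → z ≢ x → upd y (var y) σ z ≡ var z
  fixes′ z z≢x with z ≡ᵇ y in e
  ... | true  = cong var (sym (≡ᵇ-true⇒≡ e))
  ... | false = fixes z z≢x
  only-x′ : ∀ w → occT w (upd y (var y) σ x) ≡ true → w ≡ x
  only-x′ w o with x ≡ᵇ y in e
  ... | true  = trans (≡ᵇ-true⇒≡ o) (sym (≡ᵇ-true⇒≡ e))
  ... | false = only-x w o
  no-capture : ∀ z → freeIn z (∃f y A) ≡ true → occT y (σ z) ≡ false
  no-capture z fz with z ≟ x
  ... | no z≢x rewrite fixes z z≢x = ≢⇒≡ᵇ-false (free-∃⇒≢ A fz ∘ sym)
  ... | yes refl with occT y (σ z) in e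
  ...   | false = refl
  ...   | true  = ⊥-elim (free-∃⇒≢ A fz (sym (only-x y e)))
MovesOnly⇒FreeFor (s ≐ t)    _ = tt
MovesOnly⇒FreeFor ⊤f         _ = tt
MovesOnly⇒FreeFor ⊥f         _ = tt
MovesOnly⇒FreeFor (∀f _ _ _) _ = tt

eval∞-sub : ∀ t σ ρ → eval∞ ρ (subT σ t) ≡ eval∞ (eval∞ ρ ∘ σ) t
eval∞-sub (var x) σ ρ = refl
eval∞-sub 𝟎       σ ρ = refl
eval∞-sub (S t)   σ ρ = cong suc∞ (eval∞-sub t σ ρ)
eval∞-sub (s ⊕ t) σ ρ = cong₂ _+∞_ (eval∞-sub s σ ρ) (eval∞-sub t σ ρ)
eval∞-sub (s ⊗ t) σ ρ = cong₂ _*∞_ (eval∞-sub s σ ρ) (eval∞-sub t σ ρ)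

⊩-sub : ∀ A {σ ρ} → FreeFor σ A → (ρ ⊩ sub σ A) ⇔ (eval∞ ρ ∘ σ ⊩ A)
⊩-sub (s ≐ t) {σ} {ρ} _ =
  mk⇔ (λ e → trans (sym (eval∞-sub s σ ρ)) (trans e (eval∞-sub t σ ρ)))
      (λ e → trans (eval∞-sub s σ ρ) (trans e (sym (eval∞-sub t σ ρ))))
⊩-sub ⊤f _ = mk⇔ id id
⊩-sub ⊥f _ = mk⇔ id id
⊩-sub (A ∧f B) (okA , okB) =
  mk⇔ (×-map (to (⊩-sub A okA)) (to (⊩-sub B okB)))
      (×-map (from (⊩-sub A okA)) (from (⊩-sub B okB)))
⊩-sub (A ∨f B) (okA , okB) =
  mk⇔ (¬¬-map (⊎-map (to (⊩-sub A okA)) (to (⊩-sub B okB))))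
      (¬¬-map (⊎-map (from (⊩-sub A okA)) (from (⊩-sub B okB))))
⊩-sub (∃f x A) {σ} {ρ} (okA , no-capture) =
  mk⇔ (¬¬-map (map₂ λ {a} → ⊩-coincide A (shift a) ∘ to (⊩-sub A okA)))
      (¬¬-map (map₂ λ {a} → from (⊩-sub A okA) ∘ ⊩-coincide A (λ z fz → sym (shift a z fz))))
  where
  shift : ∀ a z → freeIn z A ≡ true →
          eval∞ (set x a ρ) (upd x (var x) σ z) ≡ set x a (eval∞ ρ ∘ σ) z
  shift a z fz with z ≡ᵇ x in e
  ... | true  = set-≡ x ρ
  ... | false = eval∞-coincide (σ z) (λ w o → set-≢ ρ λ { refl →
                  true≢false (trans (sym o) (no-capture z (free⇒free-∃ A (≡ᵇ-false⇒≢ e) fz))) })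
⊩-sub (∀f _ _ _) _ = mk⇔ id id

⊩-[≔] : ∀ A {x t ρ} → FreeFor (upd x t var) A → (ρ ⊩ A [ x ≔ t ]) ⇔ (set x (eval∞ ρ t) ρ ⊩ A)
⊩-[≔] A {x} {t} {ρ} ok =
  mk⇔ (⊩-cong A pointwise ∘ to (⊩-sub A ok)) (from (⊩-sub A ok) ∘ ⊩-cong A (sym ∘ pointwise))
  where
  pointwise : eval∞ ρ ∘ upd x t var ≗ set x (eval∞ ρ t) ρ
  pointwise z with z ≡ᵇ x
  ... | true  = refl
  ... | false = refl

infix 4 _≤∞_

_≤∞_ : ℕ → ℕ∞ → Set
m ≤∞ fin b = m ≤ b
m ≤∞ ∞     = ⊤

near : ℕ → ℕ∞ → ℕ∞ → Set
near m (fin a) b = b ≡ fin a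
near m ∞       b = m ≤∞ b

record Near (m : ℕ) (ρ ρ′ : Env∞) : Set where
  constructor mkNear
  field near-at : ∀ z → near m (ρ z) (ρ′ z)

open Near

near-refl : ∀ m a → near m a a
near-refl m (fin a) = refl
near-refl m ∞       = tt

≤∞-antimono : ∀ {m m′} b → m ≤ m′ → m′ ≤∞ b → m ≤∞ b
≤∞-antimono (fin b) m≤m′ m′≤b = ≤-trans m≤m′ m′≤b
≤∞-antimono ∞       _    _    = tt

near-antimono : ∀ {m m′} a b → m ≤ m′ → near m′ a b → near m a b
near-antimono (fin a) b _    e = e
near-antimono ∞       b m≤m′ p = ≤∞-antimono b m≤m′ p

Near-antimono : ∀ {m m′ ρ ρ′} → m ≤ m′ → Near m′ ρ ρ′ → Near m ρ ρ′
Near-antimono {ρ = ρ} {ρ′} m≤m′ N = mkNear λ z → near-antimono (ρ z) (ρ′ z) m≤m′ (near-at N z)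

Near-⊔ˡ : ∀ {m n ρ ρ′} → Near (m ⊔ n) ρ ρ′ → Near m ρ ρ′
Near-⊔ˡ {m} {n} = Near-antimono (m≤m⊔n m n)

Near-⊔ʳ : ∀ {m n ρ ρ′} → Near (m ⊔ n) ρ ρ′ → Near n ρ ρ′
Near-⊔ʳ {m} {n} = Near-antimono (m≤n⊔m m n)

Near-refl : ∀ m ρ → Near m ρ ρ
Near-refl m ρ = mkNear λ z → near-refl m (ρ z)

Near-set : ∀ {m} x {a b ρ ρ′} → near m a b → Near m ρ ρ′ → Near m (set x a ρ) (set x b ρ′)
Near-set {m} x near-ab N = mkNear (set-pointwise (near m) near-ab (near-at N))

≤∞-or-< : ∀ m b → m ≤∞ b ⊎ Σ ℕ λ c → b ≡ fin c × c < m
≤∞-or-< m ∞       = inj₁ tt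
≤∞-or-< m (fin c) with m ≤? c
... | yes m≤c = inj₁ m≤c
... | no  m≰c = inj₂ (c , refl , ≰⇒> m≰c)

≤∞-+∞ˡ : ∀ {m} a b → m ≤∞ a → m ≤∞ a +∞ b
≤∞-+∞ˡ (fin a) (fin b) m≤a = ≤-trans m≤a (m≤m+n a b)
≤∞-+∞ˡ (fin _) ∞       _   = tt
≤∞-+∞ˡ ∞       _       _   = tt

≤∞-+∞ʳ : ∀ {m} a b → m ≤∞ b → m ≤∞ a +∞ b
≤∞-+∞ʳ (fin a) (fin b) m≤b = ≤-trans m≤b (m≤n+m b a)
≤∞-+∞ʳ (fin _) ∞       _   = tt
≤∞-+∞ʳ ∞       _       _   = tt

≤∞-*∞ : ∀ {m} a b → m ≤∞ a → 1 ≤∞ b → m ≤∞ a *∞ b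
≤∞-*∞ (fin a)       (fin (suc b)) m≤a _ = ≤-trans m≤a (m≤m*n a (suc b))
≤∞-*∞ (fin zero)    ∞             m≤0 _ = m≤0
≤∞-*∞ (fin (suc _)) ∞             _   _ = tt
≤∞-*∞ ∞             (fin (suc _)) _   _ = tt
≤∞-*∞ ∞             ∞             _   _ = tt

near-suc∞ : ∀ m a b → near m a b → near m (suc∞ a) (suc∞ b)
near-suc∞ m (fin a) _       refl = refl
near-suc∞ m ∞       (fin b) m≤b  = ≤-trans m≤b (n≤1+n b)
near-suc∞ m ∞       ∞       _    = tt

near-+∞ : ∀ m a a′ b b′ → near m a a′ → near m b b′ → near m (a +∞ b) (a′ +∞ b′)
near-+∞ m (fin a) _  (fin b) _  refl refl = refl
near-+∞ m (fin _) a′ ∞       b′ _    q    = ≤∞-+∞ʳ a′ b′ q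
near-+∞ m ∞       a′ _       b′ p    _    = ≤∞-+∞ˡ a′ b′ p

-- Multiplication needs one extra unit of closeness to ∞, since n · 1 = n.
near-*∞ : ∀ m a a′ b b′ → near (suc m) a a′ → near (suc m) b b′ → near m (a *∞ b) (a′ *∞ b′)
near-*∞ m (fin a)       _  (fin b)       _  refl refl = refl
near-*∞ m (fin zero)    _  ∞             b′ refl _    = *∞-zeroˡ b′
near-*∞ m (fin (suc a)) _  ∞             b′ refl q    =
  subst (m ≤∞_) (*∞-comm b′ (fin (suc a)))
        (≤∞-*∞ b′ (fin (suc a)) (≤∞-antimono b′ (n≤1+n m) q) (s≤s z≤n))
near-*∞ m ∞             a′ (fin zero)    _  _    refl = *∞-zeroʳ a′
near-*∞ m ∞             a′ (fin (suc b)) _  p    refl =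
  ≤∞-*∞ a′ (fin (suc b)) (≤∞-antimono a′ (n≤1+n m) p) (s≤s z≤n)
near-*∞ m ∞             a′ ∞             b′ p    q    =
  ≤∞-*∞ a′ b′ (≤∞-antimono a′ (n≤1+n m) p) (≤∞-antimono b′ (s≤s z≤n) q)

eval∞-continuous : ∀ t ρ m → Σ ℕ λ k → ∀ {ρ′} → Near k ρ ρ′ → near m (eval∞ ρ t) (eval∞ ρ′ t)
eval∞-continuous (var x) ρ m = m , λ N → near-at N x
eval∞-continuous 𝟎       ρ m = 0 , λ _ → refl
eval∞-continuous (S t)   ρ m with eval∞-continuous t ρ m
... | k , cont = k , λ {ρ′} N → near-suc∞ m (eval∞ ρ t) (eval∞ ρ′ t) (cont N)
eval∞-continuous (s ⊕ t) ρ m with eval∞-continuous s ρ m | eval∞-continuous t ρ m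
... | k₁ , cont₁ | k₂ , cont₂ = k₁ ⊔ k₂ , λ {ρ′} N →
  near-+∞ m (eval∞ ρ s) (eval∞ ρ′ s) (eval∞ ρ t) (eval∞ ρ′ t)
    (cont₁ (Near-⊔ˡ N)) (cont₂ (Near-⊔ʳ N))
eval∞-continuous (s ⊗ t) ρ m with eval∞-continuous s ρ (suc m) | eval∞-continuous t ρ (suc m)
... | k₁ , cont₁ | k₂ , cont₂ = k₁ ⊔ k₂ , λ {ρ′} N →
  near-*∞ m (eval∞ ρ s) (eval∞ ρ′ s) (eval∞ ρ t) (eval∞ ρ′ t)
    (cont₁ (Near-⊔ˡ N)) (cont₂ (Near-⊔ʳ N))

near-separates : ∀ {a b} → a ≢ b → Σ ℕ λ m → ∀ {a′ b′} → near m a a′ → near m b b′ → a′ ≢ b′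
near-separates {fin a} {fin b} a≢b = 0 , λ { refl refl → a≢b }
near-separates {fin a} {∞}     _   = suc a , λ { refl sa≤b′ refl → 1+n≰n sa≤b′ }
near-separates {∞}     {fin b} _   = suc b , λ { sb≤a′ refl refl → 1+n≰n sb≤a′ }
near-separates {∞}     {∞}     ∞≢∞ = ⊥-elim (∞≢∞ refl)

Refuted : ℕ → Env∞ → Formula → Set
Refuted m ρ A = ∀ {ρ′} → Near m ρ ρ′ → ¬ (ρ′ ⊩ A)

Refuted-mono : ∀ {m m′ ρ} A → m ≤ m′ → Refuted m ρ A → Refuted m′ ρ A
Refuted-mono A m≤m′ R N = R (Near-antimono m≤m′ N)

¬¬-uniform-bound : (P : ℕ → ℕ → Set) → (∀ {c m m′} → m ≤ m′ → P c m → P c m′) →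
                   ∀ n → (∀ c → c < n → ¬ ¬ Σ ℕ (P c)) → ¬ ¬ Σ ℕ λ m → ∀ c → c < n → P c m
¬¬-uniform-bound P mono zero    _ = return (0 , λ _ ())
¬¬-uniform-bound P mono (suc n) h = do
  (m₁ , P<n) ← ¬¬-uniform-bound P mono n (λ c c<n → h c (m<n⇒m<1+n c<n))
  (m₂ , Pn)  ← h n ≤-refl
  return (m₁ ⊔ m₂ , λ c c<1+n →
    [ (λ c<n → mono (m≤m⊔n m₁ m₂) (P<n c c<n)) , (λ { refl → mono (m≤n⊔m m₁ m₂) Pn }) ]
      (m<1+n⇒m<n∨m≡n c<1+n))

⊭-open : ∀ A ρ → ¬ (ρ ⊩ A) → ¬ ¬ Σ ℕ λ m → Refuted m ρ A
⊭-open (s ≐ t) ρ s≢t with near-separates s≢t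
... | m , separate with eval∞-continuous s ρ m | eval∞-continuous t ρ m
...   | k₁ , cont₁ | k₂ , cont₂ =
  return (k₁ ⊔ k₂ , λ {_} N → separate (cont₁ (Near-⊔ˡ N)) (cont₂ (Near-⊔ʳ N)))
⊭-open ⊤f         ρ ⊭⊤ = ⊥-elim (⊭⊤ tt)
⊭-open ⊥f         ρ _  = return (0 , λ {_} _ ())
⊭-open (A ∧f B)   ρ ⊭A∧B = do
  inj₁ ⊭A ← (λ k → ⊭A∧B (⊩-stable A (k ∘ inj₁) , ⊩-stable B (k ∘ inj₂)))
    where inj₂ ⊭B → do (m , R) ← ⊭-open B ρ ⊭B
                       return (m , λ {_} N (_ , b) → R N b)
  (m , R) ← ⊭-open A ρ ⊭A
  return (m , λ {_} N (a , _) → R N a)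
⊭-open (A ∨f B)   ρ ⊭A∨B = do
  (m₁ , R₁) ← ⊭-open A ρ (λ a → ⊭A∨B (λ k → k (inj₁ a)))
  (m₂ , R₂) ← ⊭-open B ρ (λ b → ⊭A∨B (λ k → k (inj₂ b)))
  return (m₁ ⊔ m₂ , λ {_} N a∨b → a∨b [ R₁ (Near-⊔ˡ N) , R₂ (Near-⊔ʳ N) ])
-- A witness b ≥ m₁ is m₁-near ∞, and ∞ is refuted at distance m₁; the finitely many
-- remaining witnesses c < m₁ are refuted at a common distance m₂.
⊭-open (∃f x A)   ρ ⊭∃A = do
  (m₁ , R∞)   ← ⊭-open A (set x ∞ ρ) (fails ∞)
  (m₂ , Rfin) ← ¬¬-uniform-bound (λ c m → Refuted m (set x (fin c) ρ) A) (Refuted-mono A) m₁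
                                 (λ c _ → ⊭-open A (set x (fin c) ρ) (fails (fin c)))
  return (m₁ ⊔ m₂ , λ {_} N ∃a → ∃a λ (b , q) → witness-fails m₁ m₂ R∞ Rfin N b q)
  where
  fails : ∀ a → ¬ (set x a ρ ⊩ A)
  fails a q = ⊭∃A (λ k → k (a , q))
  witness-fails : ∀ m₁ m₂ → Refuted m₁ (set x ∞ ρ) A →
                  (∀ c → c < m₁ → Refuted m₂ (set x (fin c) ρ) A) →
                  ∀ {ρ′} → Near (m₁ ⊔ m₂) ρ ρ′ → ∀ b → ¬ (set x b ρ′ ⊩ A)
  witness-fails m₁ m₂ R∞ Rfin N b with ≤∞-or-< m₁ b
  ... | inj₁ m₁≤b = R∞ (Near-set x m₁≤b (Near-⊔ˡ N))
  ... | inj₂ (c , refl , c<m₁) = Rfin c c<m₁ (Near-set x refl (Near-⊔ʳ N))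
⊭-open (∀f _ _ _) ρ ⊭∀ = ⊥-elim (⊭∀ tt)

⊩-closed : ∀ A ρ → (∀ m → Σ Env∞ λ ρ′ → Near m ρ ρ′ × (ρ′ ⊩ A)) → ρ ⊩ A
⊩-closed A ρ approx = ⊩-stable A λ ⊭A → ⊭-open A ρ ⊭A λ (m , R) →
  let (ρ′ , N , ⊩A) = approx m in R N ⊩A

⊩-induction : ∀ A x {ρ} → (∀ {ρ} → ρ ⊩ A → ρ ⊩ A [ x ≔ S (var x) ]) → ρ ⊩ A [ x ≔ 𝟎 ] → ρ ⊩ A
⊩-induction A x {ρ} step base = ⊩-cong A (set-id x refl) (at (ρ x))
  where
  freeFor : ∀ {t} → (∀ w → occT w t ≡ true → w ≡ x) → FreeFor (upd x t var) A
  freeFor only-x = MovesOnly⇒FreeFor A (upd-movesOnly only-x)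

  successor : ∀ n → set x (suc∞ (set x (fin n) ρ x)) (set x (fin n) ρ) ≗ set x (fin (suc n)) ρ
  successor n z =
    trans (cong (λ a → set x a (set x (fin n) ρ) z) (cong suc∞ (set-≡ x ρ))) (set-shadow x ρ z)

  at-fin : ∀ n → set x (fin n) ρ ⊩ A
  at-fin zero    = to (⊩-[≔] A (freeFor λ _ ())) base
  at-fin (suc n) = ⊩-cong A (successor n) (to (⊩-[≔] A (freeFor λ _ → ≡ᵇ-true⇒≡)) (step (at-fin n)))

  at : ∀ a → set x a ρ ⊩ A
  at (fin n) = at-fin n
  at ∞       = ⊩-closed A (set x ∞ ρ) λ m →
    set x (fin m) ρ , Near-set x ≤-refl (Near-refl m ρ) , at-fin m

⊩-sound : ∀ {A B} → A ⇒ B → ∀ {ρ} → ρ ⊩ A → ρ ⊩ B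
⊩-sound ax-id p = p
⊩-sound ax-⊤ _ = tt
⊩-sound ax-⊥ ()
⊩-sound ax-dist (a , b∨c) = ¬¬-map (⊎-map (a ,_) (a ,_)) b∨c
⊩-sound (ax-∧∃ {A} nf) (a , ∃b) = ¬¬-map (map₂ (⊩-notFree-set A nf a ,_)) ∃b
⊩-sound ax-refl _ = refl
⊩-sound (ax-eq {x} {A = A} at) (e , p) =
  from (⊩-[≔] A (Atomic⇒FreeFor at)) (⊩-cong A (λ z → sym (set-id x e z)) p)
⊩-sound ax-trans _ = tt
⊩-sound ax-∧ _ = tt
⊩-sound ax-∨ _ = tt
⊩-sound (ax-inst _ _) _ = tt
⊩-sound (ax-gen _) _ = tt
⊩-sound (ax-∃ _) _ = tt
⊩-sound (r-trans d e) p = ⊩-sound e (⊩-sound d p)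
⊩-sound (r-∧I d e) p = ⊩-sound d p , ⊩-sound e p
⊩-sound (r-∧E₁ d) p = proj₁ (⊩-sound d p)
⊩-sound (r-∧E₂ d) p = proj₂ (⊩-sound d p)
⊩-sound (r-∨I {A} d e) b∨c = ⊩-stable A (¬¬-map [ ⊩-sound d , ⊩-sound e ] b∨c)
⊩-sound (r-∨E₁ d) b = ⊩-sound d (λ k → k (inj₁ b))
⊩-sound (r-∨E₂ d) c = ⊩-sound d (λ k → k (inj₂ c))
⊩-sound (r-subst {A} {B} okA okB d) p =
  from (⊩-[≔] B (SubOK⇒FreeFor B okB)) (⊩-sound d (to (⊩-[≔] A (SubOK⇒FreeFor A okA)) p))
⊩-sound (r-∃I {A} nf d) ∃b =
  ⊩-stable A (¬¬-map (λ (_ , b) → ⊩-set-notFree A nf (⊩-sound d b)) ∃b)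
⊩-sound (r-∃E {B = B} {x} _ d) {ρ} b =
  ⊩-sound d (λ k → k (ρ x , ⊩-cong B (λ z → sym (set-id x refl z)) b))
⊩-sound (r-→I _ _) _ = tt
⊩-sound ax-S0 e = suc∞≢0 _ e
⊩-sound ax-SS e = suc∞-injective e
⊩-sound ax-+0 _ = +∞-identityʳ _
⊩-sound ax-+S _ = +∞-suc _ _
⊩-sound ax-·0 _ = *∞-zeroʳ _
⊩-sound ax-·S _ = *∞-suc _ _
⊩-sound ax-ind _ = tt
⊩-sound (r-ind {A} {x} d) p = ⊩-induction A x (⊩-sound d) p

eval∞-fin : ∀ {ρ ρ∞} → ρ∞ ≗ fin ∘ ρ → ∀ t → eval∞ ρ∞ t ≡ fin (evalT ρ t)
eval∞-fin h (var x) = h x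
eval∞-fin h 𝟎       = refl
eval∞-fin h (S t)   = cong suc∞ (eval∞-fin h t)
eval∞-fin h (s ⊕ t) = cong₂ _+∞_ (eval∞-fin h s) (eval∞-fin h t)
eval∞-fin h (s ⊗ t) = cong₂ _*∞_ (eval∞-fin h s) (eval∞-fin h t)

⊨⇒⊩ : ∀ A {ρ ρ∞} → ρ∞ ≗ fin ∘ ρ → ρ ⊨ A → ρ∞ ⊩ A
⊨⇒⊩ (s ≐ t)    h e        = trans (eval∞-fin h s) (trans (cong fin e) (sym (eval∞-fin h t)))
⊨⇒⊩ ⊤f         h _        = tt
⊨⇒⊩ ⊥f         h ()
⊨⇒⊩ (A ∧f B)   h          = ×-map (⊨⇒⊩ A h) (⊨⇒⊩ B h)
⊨⇒⊩ (A ∨f B)   h a∨b k    = k (⊎-map (⊨⇒⊩ A h) (⊨⇒⊩ B h) a∨b)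
⊨⇒⊩ (∃f x A)   h (n , a) k = k (fin n , ⊨⇒⊩ A (set-pointwise (λ a n → a ≡ fin n) refl h) a)
⊨⇒⊩ (∀f _ _ _) h _        = tt

∸-graph-not-provably-functional :
  ∀ {A x₁ x₂ y u v} → Unique (y ∷ x₁ ∷ x₂ ∷ []) → u ≢ v → u ∉ x₁ ∷ x₂ ∷ [] → v ∉ x₁ ∷ x₂ ∷ [] →
  (∀ z → freeIn z A ≡ true → z ∈ y ∷ x₁ ∷ x₂ ∷ []) →
  (∀ n k → set y k (set x₁ (n + k) (set x₂ n (λ _ → 0))) ⊨ A) →
  SubOK1 y (var u) A → SubOK1 y (var v) A →
  ¬ (A [ y ≔ var u ] ∧f A [ y ≔ var v ] ⇒ var u ≐ var v)
∸-graph-not-provably-functional {A} {x₁} {x₂} {y} {u} {v}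
  ((y≢x₁ ∷ y≢x₂ ∷ []) ∷ (x₁≢x₂ ∷ []) ∷ _) u≢v u∉ v∉ free graph u-ok v-ok unique =
  0≢1 (trans (sym ρu) (trans (⊩-sound unique (at u ρu u-ok , at v ρv v-ok)) ρv))
  where
  0≢1 : fin 0 ≢ fin 1
  0≢1 ()

  ρᵥ : Env∞
  ρᵥ = set v (fin 1) (λ _ → ∞)

  ρ : Env∞
  ρ = set u (fin 0) ρᵥ

  ρu : ρ u ≡ fin 0
  ρu = set-≡ u ρᵥ

  ρv : ρ v ≡ fin 1
  ρv = trans (set-≢ {a = fin 0} ρᵥ (u≢v ∘ sym)) (set-≡ v (λ _ → ∞))

  x≢y : ∀ {z} → z ∈ x₁ ∷ x₂ ∷ [] → z ≢ y
  x≢y (here refl)         = y≢x₁ ∘ sym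
  x≢y (there (here refl)) = y≢x₂ ∘ sym

  ρx : ∀ {z} → z ∈ x₁ ∷ x₂ ∷ [] → ρ z ≡ ∞
  ρx {z} z∈ = trans (set-≢ {x = u} {z} {fin 0} ρᵥ λ { refl → u∉ z∈ })
                    (set-≢ {x = v} {z} {fin 1} (λ _ → ∞) λ { refl → v∉ z∈ })

  ∞∞ : Env∞
  ∞∞ = set x₁ ∞ (set x₂ ∞ (λ _ → fin 0))

  ∞∞x : ∀ {z} → z ∈ x₁ ∷ x₂ ∷ [] → ∞∞ z ≡ ∞
  ∞∞x (here refl)         = set-≡ x₁ (set x₂ ∞ (λ _ → fin 0))
  ∞∞x (there (here refl)) =
    trans (set-≢ {a = ∞} (set x₂ ∞ (λ _ → fin 0)) (x₁≢x₂ ∘ sym)) (set-≡ x₂ (λ _ → fin 0))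

  graph-at-∞ : ∀ k → set y (fin k) ∞∞ ⊩ A
  graph-at-∞ k = ⊩-closed A (set y (fin k) ∞∞) λ n →
    set y (fin k) (set x₁ (fin (n + k)) (set x₂ (fin n) (λ _ → fin 0))) ,
    Near-set y refl (Near-set x₁ (m≤m+n n k) (Near-set x₂ ≤-refl (Near-refl n (λ _ → fin 0)))) ,
    ⊨⇒⊩ A (set-pointwise fin-of {y} refl
             (set-pointwise fin-of {x₁} refl (set-pointwise fin-of {x₂} refl (λ _ → refl))))
          (graph n k)
    where
    fin-of : ℕ∞ → ℕ → Set
    fin-of a m = a ≡ fin m

  at : ∀ w {k} → ρ w ≡ fin k → SubOK1 y (var w) A → ρ ⊩ A [ y ≔ var w ]
  at w {k} ρw ok = from (⊩-[≔] A (SubOK⇒FreeFor A ok)) (⊩-coincide A agree (graph-at-∞ k))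
    where
    agree : ∀ z → freeIn z A ≡ true → set y (fin k) ∞∞ z ≡ set y (ρ w) ρ z
    agree z fz with free z fz
    ... | here refl = trans (set-≡ y ∞∞) (sym (trans (set-≡ y ρ) ρw))
    ... | there z∈  = trans (set-≢ {a = fin k} ∞∞ (x≢y z∈))
                         (trans (∞∞x z∈) (sym (trans (set-≢ {a = ρ w} ρ (x≢y z∈)) (ρx z∈))))

corollary3p20 : ¬ ProvablyRecursive 2 monus
corollary3p20 record { A = A ; xs = x₁ ∷ x₂ ∷ [] ; y = y ; distinct = distinct ; freeVars = freeVars
                     ; complete = complete ; u = u ; v = v ; u≢v = u≢v ; u-fresh = u-fresh
                     ; v-fresh = v-fresh ; u-ok = u-ok ; v-ok = v-ok ; unique = unique } =
  ∸-graph-not-provably-functional distinct u≢v (u-fresh ∘ there) (v-fresh ∘ there) freeVars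
    (λ n k → complete (n + k ∷ n ∷ []) k (m+n∸m≡n n k)) u-ok v-ok unique
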